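{- Let $I$ be an arbitrary instance of $\text{NKP}^u$ and let $e_{ik}\in M$. If $p_{ik} > R\left(t_M - t_{M\setminus\{e_{ik}\}}\right)$, then $e_{ik}$ is a compulsory item, i.e. for every subset $O\subseteq M\setminus\{e_{ik}\}$ we have $f(O\cup\{e_{ik}\})>f(O)$.
   Context: An instance consists of a route of $n+1$ distinct cities $1,\dots,n+1$ visited in this order, distances $d_i>0$ between cities $i$ and $i+1$ ($1\le i\le n$), and for each city $i\le n$ a set of items $M_i=\{e_{i1},\dots,e_{im_i}\}$; $M=\bigcup_{i=1}^n M_i$. Each item $e_{ik}$ has a positive integer profit $p_{ik}$ and a nonnegative weight $w_{ik}$. Further given are a capacity $W$, velocities $0<\upsilon_{\min}<\upsilon_{\max}$, a rent rate $R>0$, and $\nu=(\upsilon_{\max}-\upsilon_{\min})/W$. In $\text{NKP}^u$ one has $W\ge\sum_{e_{ik}\in M}w_{ik}$, so every subset of $M$ is a feasible selection. For $O\subseteq M$ let $O_j=O\cap M_j$ and define the total travel time $$t_O=\sum_{i=1}^n \frac{d_i}{\upsilon_{\max}-\nu\sum_{j=1}^i\sum_{e_{jk}\in O_j} w_{jk}},$$ and the objective value of the selection $O$ as $f(O)=\sum_{e_{jl}\in O}p_{jl}-R\,t_O$. An item is called compulsory if its inclusion in any packing plan (not containing it) strictly increases the objective value.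
   Formalization: The distances $d_i$, the item weights, the capacity $W$, the velocities and the rent rate $R$ are rational. -}

module Defs where

open import Data.Nat as ℕ using (ℕ; zero; suc)
open import Data.Fin using (Fin; toℕ) renaming (zero to fz; suc to fs)
open import Data.Bool using (Bool; true; false; if_then_else_; _∧_; _∨_; not)
open import Data.Rational using (ℚ; 0ℚ; _+_; _-_; _*_; _÷_; _<_; _≤_; 1/_; ≢-nonZero)
open import Data.Rational.Properties using (_≟_)
open import Data.Integer using (+_)
open import Relation.Nullary using (yes; no)
open import Relation.Nullary.Decidable using (⌊_⌋)

ℕ→ℚ : ℕ → ℚ
ℕ→ℚ n = Data.Rational._/_ (+ n) 1

-- Total reciprocal: 1/q for q ≠ 0, and 0 for q = 0.  In the statement it is
-- only applied to provably positive quantities, so the junk value is irrelevant.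
inv : ℚ → ℚ
inv q with q ≟ 0ℚ
... | yes _ = 0ℚ
... | no q≢0 = 1/_ q {{≢-nonZero q≢0}}

sumFin : (n : ℕ) → (Fin n → ℚ) → ℚ
sumFin zero    f = 0ℚ
sumFin (suc n) f = f fz + sumFin n (λ j → f (fs j))

-- An instance of NKP^u.  Cities 1..n are Fin n (city n+1 carries no items);
-- city i has m i items, indexed by Fin (m i).
record Instance : Set where
  field
    n      : ℕ
    d      : Fin n → ℚ
    m      : Fin n → ℕ
    p      : (i : Fin n) → Fin (m i) → ℕ
    w      : (i : Fin n) → Fin (m i) → ℚ
    W      : ℚ
    vmin   : ℚ
    vmax   : ℚ
    R      : ℚ
    d-pos    : ∀ i → 0ℚ < d i
    p-pos    : ∀ i k → 0 ℕ.< p i k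
    w-nonneg : ∀ i k → 0ℚ ≤ w i k
    W-pos    : 0ℚ < W
    vmin-pos : 0ℚ < vmin
    vmin<vmax : vmin < vmax
    R-pos    : 0ℚ < R
    -- NKP^u: the capacity is at least the total weight of all items
    W-unconstrained : sumFin n (λ i → sumFin (m i) (λ k → w i k)) ≤ W

  ν : ℚ
  ν = (vmax - vmin) * inv W

  Plan : Set
  Plan = (i : Fin n) → Fin (m i) → Bool

  weightAt : Plan → Fin n → ℚ
  weightAt O j = sumFin (m j) (λ k → if O j k then w j k else 0ℚ)

  cumWeight : Plan → Fin n → ℚ
  cumWeight O i = sumFin n (λ j → if ⌊ toℕ j ℕ.≤? toℕ i ⌋ then weightAt O j else 0ℚ)

  t : Plan → ℚ
  t O = sumFin n (λ i → d i * inv (vmax - ν * cumWeight O i))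

  profit : Plan → ℚ
  profit O = sumFin n (λ j → sumFin (m j) (λ k → if O j k then ℕ→ℚ (p j k) else 0ℚ))

  f : Plan → ℚ
  f O = profit O - R * t O

  isItem : (i : Fin n) → Fin (m i) → (j : Fin n) → Fin (m j) → Bool
  isItem i k j l = (toℕ j ℕ.≡ᵇ toℕ i) ∧ (toℕ l ℕ.≡ᵇ toℕ k)

  allItems : Plan
  allItems _ _ = true

  without : (i : Fin n) → Fin (m i) → Plan
  without i k j l = not (isItem i k j l)

  insert : Plan → (i : Fin n) → Fin (m i) → Plan
  insert O i k j l = isItem i k j l ∨ O j l

module Submission where

-- The travel-time term of a city, d / (vmax - ν z) as a function of
-- the weight z carried there, has increasing increments on the region where
-- the speed stays positive: adding a weight D costs more time on top of a
-- heavier load.  Cumulative weights are monotone in the packing plan and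
-- additive over disjoint unions, so travel time is "supermodular": adding
-- a set E of items to a plan Y costs at most as much time as adding E to a
-- larger plan Y' ⊇ Y.  For O ⊆ M ∖ {e} this gives
--     t(O ∪ {e}) - t(O)  ≤  t(M) - t(M ∖ {e}),
-- hence f(O ∪ {e}) - f(O) = p_e - R (t(O ∪ {e}) - t(O)) > 0 by hypothesis.

open import Defs
open import Data.Fin using (Fin)
open import Data.Bool using (false)
open import Data.Rational using (_*_; _-_; _<_)
open import Relation.Binary.PropositionalEquality using (_≡_)

open import Data.Fin using (toℕ) renaming (zero to fz; suc to fs)
open import Data.Fin.Properties using (toℕ-injective)
open import Data.Bool using (Bool; true; if_then_else_; _∧_; _∨_; not; T)
open import Data.Bool.Properties using (∨-comm; ∨-inverseˡ)
import Data.Nat as ℕ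
open import Data.Nat.Properties using (≡ᵇ⇒≡)
open import Data.Product using (_×_; _,_; proj₁; proj₂)
open import Data.Rational using (ℚ; 0ℚ; 1ℚ; _+_; _≤_; -_; nonNegative; positive; ≢-nonZero)
open import Data.Rational.Properties
open import Data.Rational.Solver using (module +-*-Solver)
open import Relation.Binary.PropositionalEquality
  using (refl; sym; trans; cong; cong₂; subst; subst₂; module ≡-Reasoning)
open import Relation.Nullary using (yes; no)
open import Relation.Nullary.Decidable using (⌊_⌋)
open import Data.Empty using (⊥-elim)
open +-*-Solver using (solve; _:=_; _:+_; _:*_; _:-_; :-_)

0≤q-p : ∀ {p q} → p ≤ q → 0ℚ ≤ q - p
0≤q-p {p} {q} p≤q = subst (_≤ q - p) (+-inverseʳ p) (+-monoˡ-≤ (- p) p≤q)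

p<q⇒0<q-p : ∀ {p q} → p < q → 0ℚ < q - p
p<q⇒0<q-p {p} {q} p<q = subst (_< q - p) (+-inverseʳ p) (+-monoˡ-< (- p) p<q)

0<q-p⇒p<q : ∀ {p q} → 0ℚ < q - p → p < q
0<q-p⇒p<q {p} {q} h =
  subst₂ _<_ (+-identityˡ p) (solve 2 (λ p q → q :- p :+ p := q) refl p q) (+-monoˡ-< p h)

minus-antitone : ∀ V {x y} → y ≤ x → V - x ≤ V - y
minus-antitone V y≤x = +-monoʳ-≤ V (neg-antimono-≤ y≤x)

*-nonNeg : ∀ {x y} → 0ℚ ≤ x → 0ℚ ≤ y → 0ℚ ≤ x * y
*-nonNeg {x} {y} 0≤x 0≤y =
  subst (_≤ x * y) (*-zeroʳ x) (*-monoˡ-≤-nonNeg x {{nonNegative 0≤x}} 0≤y)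

*-monoˡ-≤-0≤ : ∀ r {x y} → 0ℚ ≤ r → x ≤ y → r * x ≤ r * y
*-monoˡ-≤-0≤ r 0≤r = *-monoˡ-≤-nonNeg r {{nonNegative 0≤r}}

*-monoʳ-≤-0≤ : ∀ r {x y} → 0ℚ ≤ r → x ≤ y → x * r ≤ y * r
*-monoʳ-≤-0≤ r 0≤r = *-monoʳ-≤-nonNeg r {{nonNegative 0≤r}}

inv-inverseʳ : ∀ q → 0ℚ < q → q * inv q ≡ 1ℚ
inv-inverseʳ q 0<q with q ≟ 0ℚ
... | yes q≡0 = ⊥-elim (<-irrefl (sym q≡0) 0<q)
... | no q≢0 = *-inverseʳ q {{≢-nonZero q≢0}}

inv-nonNeg : ∀ q → 0ℚ < q → 0ℚ ≤ inv q
inv-nonNeg q 0<q with q ≟ 0ℚ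
... | yes _ = ≤-refl
... | no q≢0 = <⇒≤ (positive⁻¹ _ {{1/pos⇒pos q {{positive 0<q}}}})

inv-antitone : ∀ {u v} → 0ℚ < v → v ≤ u → inv u ≤ inv v
inv-antitone {u} {v} 0<v v≤u = begin
  inv u                ≡⟨ sym (*-identityʳ (inv u)) ⟩
  inv u * 1ℚ           ≡⟨ cong (inv u *_) (sym (inv-inverseʳ v 0<v)) ⟩
  inv u * (v * inv v)  ≡⟨ solve 3 (λ a x b → a :* (x :* b) := (a :* b) :* x) refl (inv u) v (inv v) ⟩
  (inv u * inv v) * v  ≤⟨ *-monoˡ-≤-0≤ (inv u * inv v) 0≤invs v≤u ⟩
  (inv u * inv v) * u  ≡⟨ solve 3 (λ a x b → (a :* b) :* x := b :* (x :* a)) refl (inv u) u (inv v) ⟩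
  inv v * (u * inv u)  ≡⟨ cong (inv v *_) (inv-inverseʳ u 0<u) ⟩
  inv v * 1ℚ           ≡⟨ *-identityʳ (inv v) ⟩
  inv v                ∎
  where
  open ≤-Reasoning
  0<u = <-≤-trans 0<v v≤u
  0≤invs = *-nonNeg (inv-nonNeg u 0<u) (inv-nonNeg v 0<v)

inv-difference : ∀ {u u'} → 0ℚ < u → 0ℚ < u' → inv u' - inv u ≡ inv u * inv u' * (u - u')
inv-difference {u} {u'} 0<u 0<u' = sym (begin
  α * α' * (u - u')             ≡⟨ solve 4 (λ a a' x x' → a :* a' :* (x :- x')
                                                     := a' :* (x :* a) :- a :* (x' :* a'))
                                          refl α α' u u' ⟩
  α' * (u * α) - α * (u' * α')  ≡⟨ cong₂ (λ s r → α' * s - α * r)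
                                          (inv-inverseʳ u 0<u) (inv-inverseʳ u' 0<u') ⟩
  α' * 1ℚ - α * 1ℚ              ≡⟨ cong₂ _-_ (*-identityʳ α') (*-identityʳ α) ⟩
  α' - α                        ∎)
  where
  open ≡-Reasoning
  α = inv u
  α' = inv u'

-- Both increments equal
-- ν D / ((V - ν z)(V - ν (z + D))), and the denominators shrink as z grows.
reciprocal-increments : ∀ V ν a b D → 0ℚ ≤ ν → a ≤ b → 0ℚ ≤ D → 0ℚ < V - ν * (b + D) →
  inv (V - ν * (a + D)) - inv (V - ν * a) ≤ inv (V - ν * (b + D)) - inv (V - ν * b)
reciprocal-increments V ν a b D 0≤ν a≤b 0≤D 0<v' = begin
  inv u' - inv u             ≡⟨ inv-difference 0<u 0<u' ⟩
  inv u * inv u' * (u - u')  ≡⟨ cong (inv u * inv u' *_) (drop a) ⟩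
  inv u * inv u' * (ν * D)   ≤⟨ *-monoʳ-≤-0≤ (ν * D) (*-nonNeg 0≤ν 0≤D) products ⟩
  inv v * inv v' * (ν * D)   ≡⟨ cong (inv v * inv v' *_) (sym (drop b)) ⟩
  inv v * inv v' * (v - v')  ≡⟨ sym (inv-difference 0<v 0<v') ⟩
  inv v' - inv v             ∎
  where
  open ≤-Reasoning
  u = V - ν * a
  u' = V - ν * (a + D)
  v = V - ν * b
  v' = V - ν * (b + D)
  drop : ∀ z → (V - ν * z) - (V - ν * (z + D)) ≡ ν * D
  drop z = solve 4 (λ V ν z D → (V :- ν :* z) :- (V :- ν :* (z :+ D)) := ν :* D) refl V ν z D
  v'≤v : v' ≤ v
  v'≤v = minus-antitone V (*-monoˡ-≤-0≤ ν 0≤ν b≤b+D)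
    where b≤b+D = subst (_≤ b + D) (+-identityʳ b) (+-monoʳ-≤ b 0≤D)
  v≤u : v ≤ u
  v≤u = minus-antitone V (*-monoˡ-≤-0≤ ν 0≤ν a≤b)
  v'≤u' : v' ≤ u'
  v'≤u' = minus-antitone V (*-monoˡ-≤-0≤ ν 0≤ν (+-monoˡ-≤ D a≤b))
  0<v = <-≤-trans 0<v' v'≤v
  0<u = <-≤-trans 0<v v≤u
  0<u' = <-≤-trans 0<v' v'≤u'
  products : inv u * inv u' ≤ inv v * inv v'
  products = ≤-trans (*-monoʳ-≤-0≤ (inv u') (inv-nonNeg u' 0<u') (inv-antitone 0<v v≤u))
                     (*-monoˡ-≤-0≤ (inv v) (inv-nonNeg v 0<v) (inv-antitone 0<v' v'≤u'))

sumFin-cong : ∀ n {f g : Fin n → ℚ} → (∀ j → f j ≡ g j) → sumFin n f ≡ sumFin n g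
sumFin-cong ℕ.zero    f≡g = refl
sumFin-cong (ℕ.suc n) f≡g = cong₂ _+_ (f≡g fz) (sumFin-cong n (λ j → f≡g (fs j)))

sumFin-+ : ∀ n (f g : Fin n → ℚ) → sumFin n (λ j → f j + g j) ≡ sumFin n f + sumFin n g
sumFin-+ ℕ.zero    f g = sym (+-identityˡ 0ℚ)
sumFin-+ (ℕ.suc n) f g =
  trans (cong (f fz + g fz +_) (sumFin-+ n (λ j → f (fs j)) (λ j → g (fs j))))
        (solve 4 (λ a b c e → a :+ b :+ (c :+ e) := a :+ c :+ (b :+ e)) refl
               (f fz) (g fz) (sumFin n (λ j → f (fs j))) (sumFin n (λ j → g (fs j))))

sumFin-- : ∀ n (f g : Fin n → ℚ) → sumFin n (λ j → f j - g j) ≡ sumFin n f - sumFin n g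
sumFin-- ℕ.zero    f g = refl
sumFin-- (ℕ.suc n) f g =
  trans (cong (f fz - g fz +_) (sumFin-- n (λ j → f (fs j)) (λ j → g (fs j))))
        (solve 4 (λ a b c e → a :- b :+ (c :- e) := a :+ c :- (b :+ e)) refl
               (f fz) (g fz) (sumFin n (λ j → f (fs j))) (sumFin n (λ j → g (fs j))))

sumFin-mono : ∀ n {f g : Fin n → ℚ} → (∀ j → f j ≤ g j) → sumFin n f ≤ sumFin n g
sumFin-mono ℕ.zero    f≤g = ≤-refl
sumFin-mono (ℕ.suc n) f≤g = +-mono-≤ (f≤g fz) (sumFin-mono n (λ j → f≤g (fs j)))

sumFin-zero : ∀ n → sumFin n (λ _ → 0ℚ) ≡ 0ℚ
sumFin-zero ℕ.zero    = refl
sumFin-zero (ℕ.suc n) = trans (+-identityˡ _) (sumFin-zero n)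

sumFin-nonNeg : ∀ n {f : Fin n → ℚ} → (∀ j → 0ℚ ≤ f j) → 0ℚ ≤ sumFin n f
sumFin-nonNeg n {f} 0≤f = subst (_≤ sumFin n f) (sumFin-zero n) (sumFin-mono n 0≤f)

false≢true : {A : Set} → false ≡ true → A
false≢true ()

ind : Bool → ℚ → ℚ
ind b x = if b then x else 0ℚ

sumFin-δ : ∀ n (i : Fin n) (g : Fin n → ℚ) →
  sumFin n (λ j → ind (toℕ j ℕ.≡ᵇ toℕ i) (g j)) ≡ g i
sumFin-δ (ℕ.suc n) fz     g = trans (cong (g fz +_) (sumFin-zero n)) (+-identityʳ (g fz))
sumFin-δ (ℕ.suc n) (fs i) g = trans (+-identityˡ _) (sumFin-δ n i (λ j → g (fs j)))

sumFin-ind-∧ : ∀ m (a : Bool) (g : Fin m → Bool) (x : Fin m → ℚ) →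
  sumFin m (λ l → ind (a ∧ g l) (x l)) ≡ ind a (sumFin m (λ l → ind (g l) (x l)))
sumFin-ind-∧ m true  g x = refl
sumFin-ind-∧ m false g x = sumFin-zero m

ind-∨-disjoint : ∀ (a b : Bool) x → (b ≡ true → a ≡ false) → ind (a ∨ b) x ≡ ind a x + ind b x
ind-∨-disjoint true  true  x b⇒¬a with b⇒¬a refl
... | ()
ind-∨-disjoint true  false x _ = sym (+-identityʳ x)
ind-∨-disjoint false true  x _ = sym (+-identityˡ x)
ind-∨-disjoint false false x _ = sym (+-identityˡ 0ℚ)

ind-+ : ∀ (b : Bool) x y → ind b (x + y) ≡ ind b x + ind b y
ind-+ true  x y = refl
ind-+ false x y = sym (+-identityˡ 0ℚ)

ind-nonNeg : ∀ (b : Bool) {x} → 0ℚ ≤ x → 0ℚ ≤ ind b x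
ind-nonNeg true  0≤x = 0≤x
ind-nonNeg false 0≤x = ≤-refl

ind-≤ : ∀ (b : Bool) {x} → 0ℚ ≤ x → ind b x ≤ x
ind-≤ true  0≤x = ≤-refl
ind-≤ false 0≤x = 0≤x

ind-mono : ∀ (b : Bool) {x y} → x ≤ y → ind b x ≤ ind b y
ind-mono true  x≤y = x≤y
ind-mono false x≤y = ≤-refl

ind-implies : ∀ (a b : Bool) {x} → 0ℚ ≤ x → (a ≡ true → b ≡ true) → ind a x ≤ ind b x
ind-implies true  b 0≤x a⇒b rewrite a⇒b refl = ≤-refl
ind-implies false b 0≤x a⇒b = ind-nonNeg b 0≤x

module Plans (I : Instance) where
  open Instance I

  ItemValues : Set
  ItemValues = (j : Fin n) → Fin (m j) → ℚ

  profits : ItemValues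
  profits j l = ℕ→ℚ (p j l)

  -- Σ_{e_jl ∈ X_j} v_jl; weightAt X is citySum X w by definition.
  citySum : Plan → ItemValues → Fin n → ℚ
  citySum X v j = sumFin (m j) (λ l → ind (X j l) (v j l))

  precedes : Fin n → Fin n → Bool
  precedes j c = ⌊ toℕ j ℕ.≤? toℕ c ⌋

  -- Σ_{j ≤ c} g j; cumWeight X c is prefixSum c (weightAt X) by definition.
  prefixSum : Fin n → (Fin n → ℚ) → ℚ
  prefixSum c g = sumFin n (λ j → ind (precedes j c) (g j))

  _⊆_ : Plan → Plan → Set
  X ⊆ Y = ∀ j l → X j l ≡ true → Y j l ≡ true

  DisjointUnion : Plan → Plan → Plan → Set
  DisjointUnion X Y E = ∀ j l → (X j l ≡ Y j l ∨ E j l) × (E j l ≡ true → Y j l ≡ false)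

  isItem-sound : ∀ {i k j l} (P : (j : Fin n) → Fin (m j) → Set) →
    P i k → isItem i k j l ≡ true → P j l
  isItem-sound {i} {k} {j} {l} P Pik eq
    with toℕ j ℕ.≡ᵇ toℕ i in j≡ᵇi | toℕ l ℕ.≡ᵇ toℕ k in l≡ᵇk
  ... | false | _     = false≢true eq
  ... | true  | false = false≢true eq
  ... | true  | true
    with toℕ-injective {i = j} {j = i} (≡ᵇ⇒≡ (toℕ j) (toℕ i) (subst T (sym j≡ᵇi) _))
  ... | refl
    with toℕ-injective {i = l} {j = k} (≡ᵇ⇒≡ (toℕ l) (toℕ k) (subst T (sym l≡ᵇk) _))
  ... | refl = Pik

  insert-disjointUnion : ∀ O i k → O i k ≡ false → DisjointUnion (insert O i k) O (isItem i k)
  insert-disjointUnion O i k Oik j l =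
    ∨-comm (isItem i k j l) (O j l) , isItem-sound (λ j l → O j l ≡ false) Oik

  all-disjointUnion : ∀ i k → DisjointUnion allItems (without i k) (isItem i k)
  all-disjointUnion i k j l = sym (∨-inverseˡ (isItem i k j l)) , cong not

  ⊆-without : ∀ O i k → O i k ≡ false → O ⊆ without i k
  ⊆-without O i k Oik j l Ojl with isItem i k j l in e
  ... | true  = false≢true (trans (sym (isItem-sound (λ j l → O j l ≡ false) Oik e)) Ojl)
  ... | false = refl

  citySum-split : ∀ {X Y E} → DisjointUnion X Y E → ∀ v j →
    citySum X v j ≡ citySum Y v j + citySum E v j
  citySum-split {X} {Y} {E} split v j =
    trans (sumFin-cong (m j) (λ l → trans (cong (λ b → ind b (v j l)) (proj₁ (split j l)))
                                          (ind-∨-disjoint (Y j l) (E j l) (v j l) (proj₂ (split j l)))))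
          (sumFin-+ (m j) (λ l → ind (Y j l) (v j l)) (λ l → ind (E j l) (v j l)))

  citySum-mono : ∀ {X Y} → X ⊆ Y → ∀ v → (∀ j l → 0ℚ ≤ v j l) →
    ∀ j → citySum X v j ≤ citySum Y v j
  citySum-mono {X} {Y} X⊆Y v 0≤v j =
    sumFin-mono (m j) (λ l → ind-implies (X j l) (Y j l) (0≤v j l) (X⊆Y j l))

  weightAt-nonNeg : ∀ X j → 0ℚ ≤ weightAt X j
  weightAt-nonNeg X j = sumFin-nonNeg (m j) (λ l → ind-nonNeg (X j l) (w-nonneg j l))

  prefixSum-+ : ∀ c f g → prefixSum c (λ j → f j + g j) ≡ prefixSum c f + prefixSum c g
  prefixSum-+ c f g =
    trans (sumFin-cong n (λ j → ind-+ (precedes j c) (f j) (g j)))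
          (sumFin-+ n (λ j → ind (precedes j c) (f j)) (λ j → ind (precedes j c) (g j)))

  prefixSum-mono : ∀ c {f g} → (∀ j → f j ≤ g j) → prefixSum c f ≤ prefixSum c g
  prefixSum-mono c f≤g = sumFin-mono n (λ j → ind-mono (precedes j c) (f≤g j))

  cumWeight-split : ∀ {X Y E} → DisjointUnion X Y E → ∀ c →
    cumWeight X c ≡ cumWeight Y c + cumWeight E c
  cumWeight-split {X} {Y} {E} split c =
    trans (sumFin-cong n (λ j → cong (ind (precedes j c)) (citySum-split split w j)))
          (prefixSum-+ c (weightAt Y) (weightAt E))

  cumWeight-mono : ∀ {X Y} → X ⊆ Y → ∀ c → cumWeight X c ≤ cumWeight Y c
  cumWeight-mono X⊆Y c = prefixSum-mono c (citySum-mono X⊆Y w w-nonneg)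

  cumWeight-nonNeg : ∀ X c → 0ℚ ≤ cumWeight X c
  cumWeight-nonNeg X c = sumFin-nonNeg n (λ j → ind-nonNeg (precedes j c) (weightAt-nonNeg X j))

  cumWeight-≤-W : ∀ X c → cumWeight X c ≤ W
  cumWeight-≤-W X c = ≤-trans (sumFin-mono n perCity) W-unconstrained
    where
    perCity : ∀ j → ind (precedes j c) (weightAt X j) ≤ weightAt allItems j
    perCity j = ≤-trans (ind-≤ (precedes j c) (weightAt-nonNeg X j))
                        (citySum-mono {X} {allItems} (λ _ _ _ → refl) w w-nonneg j)

  ν-nonNeg : 0ℚ ≤ ν
  ν-nonNeg = *-nonNeg (0≤q-p (<⇒≤ vmin<vmax)) (inv-nonNeg W W-pos)

  speed-at-capacity : vmax - ν * W ≡ vmin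
  speed-at-capacity = begin
    vmax - (vmax - vmin) * inv W * W    ≡⟨ solve 4 (λ a b c x → a :- (a :- b) :* c :* x
                                                      := a :- (a :- b) :* (x :* c))
                                                   refl vmax vmin (inv W) W ⟩
    vmax - (vmax - vmin) * (W * inv W)  ≡⟨ cong (λ z → vmax - (vmax - vmin) * z) (inv-inverseʳ W W-pos) ⟩
    vmax - (vmax - vmin) * 1ℚ           ≡⟨ cong (λ z → vmax - z) (*-identityʳ (vmax - vmin)) ⟩
    vmax - (vmax - vmin)                ≡⟨ solve 2 (λ a b → a :- (a :- b) := b) refl vmax vmin ⟩
    vmin                                ∎
    where open ≡-Reasoning

  speed-positive : ∀ X c → 0ℚ < vmax - ν * cumWeight X c
  speed-positive X c = <-≤-trans vmin-pos
    (subst (_≤ vmax - ν * cumWeight X c) speed-at-capacity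
           (minus-antitone vmax (*-monoˡ-≤-0≤ ν ν-nonNeg (cumWeight-≤-W X c))))

  legTime : Fin n → ℚ → ℚ
  legTime c z = d c * inv (vmax - ν * z)

  legTime-increments : ∀ c a b D → a ≤ b → 0ℚ ≤ D → 0ℚ < vmax - ν * (b + D) →
    legTime c (a + D) - legTime c a ≤ legTime c (b + D) - legTime c b
  legTime-increments c a b D a≤b 0≤D 0<speed =
    subst₂ _≤_ (factor (inv (vmax - ν * (a + D))) (inv (vmax - ν * a)))
               (factor (inv (vmax - ν * (b + D))) (inv (vmax - ν * b)))
               (*-monoˡ-≤-0≤ (d c) (<⇒≤ (d-pos c))
                 (reciprocal-increments vmax ν a b D ν-nonNeg a≤b 0≤D 0<speed))
    where
    factor : ∀ x y → d c * (x - y) ≡ d c * x - d c * y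
    factor x y = solve 3 (λ δ x y → δ :* (x :- y) := δ :* x :- δ :* y) refl (d c) x y

  travel-time-supermodular : ∀ {X Y X' Y' E} →
    DisjointUnion X Y E → DisjointUnion X' Y' E → Y ⊆ Y' → t X - t Y ≤ t X' - t Y'
  travel-time-supermodular {X} {Y} {X'} {Y'} {E} split split' Y⊆Y' =
    subst₂ _≤_ (sumFin-- n (time X) (time Y)) (sumFin-- n (time X') (time Y')) (sumFin-mono n perLeg)
    where
    time : Plan → Fin n → ℚ
    time Z c = legTime c (cumWeight Z c)
    perLeg : ∀ c → time X c - time Y c ≤ time X' c - time Y' c
    perLeg c
      rewrite cumWeight-split split c | cumWeight-split split' c =
      legTime-increments c (cumWeight Y c) (cumWeight Y' c) (cumWeight E c)
        (cumWeight-mono Y⊆Y' c) (cumWeight-nonNeg E c)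
        (subst (λ z → 0ℚ < vmax - ν * z) (cumWeight-split split' c) (speed-positive X' c))

  profit-split : ∀ {X Y E} → DisjointUnion X Y E → profit X ≡ profit Y + profit E
  profit-split {X} {Y} {E} split =
    trans (sumFin-cong n (citySum-split split profits))
          (sumFin-+ n (citySum Y profits) (citySum E profits))

  profit-item : ∀ i k → profit (isItem i k) ≡ ℕ→ℚ (p i k)
  profit-item i k =
    trans (sumFin-cong n (λ j → sumFin-ind-∧ (m j) (toℕ j ℕ.≡ᵇ toℕ i) (isK j) (profits j)))
          (trans (sumFin-δ n i (citySum isK profits))
                 (sumFin-δ (m i) k (profits i)))
    where
    isK : Plan
    isK j l = toℕ l ℕ.≡ᵇ toℕ k

  objective-gain : ∀ {X Y E} → DisjointUnion X Y E → f X - f Y ≡ profit E - R * (t X - t Y)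
  objective-gain {X} {Y} {E} split =
    trans (cong (λ P → P - R * t X - f Y) (profit-split split))
          (solve 5 (λ PY PE r tX tY → PY :+ PE :- r :* tX :- (PY :- r :* tY)
                                   := PE :- r :* (tX :- tY))
                 refl (profit Y) (profit E) R (t X) (t Y))

proposition1 : (I : Instance) → let open Instance I in
    (i : Fin n) (k : Fin (m i)) →
    R * (t allItems - t (without i k)) < ℕ→ℚ (p i k) →
    (O : Plan) → O i k ≡ false →
    f O < f (insert O i k)
proposition1 I i k hyp O Oik = 0<q-p⇒p<q (subst (0ℚ <_) (sym gain) (p<q⇒0<q-p rent<profit))
  where
  open Instance I
  open Plans I
  extra-time : t (insert O i k) - t O ≤ t allItems - t (without i k)
  extra-time = travel-time-supermodular (insert-disjointUnion O i k Oik) (all-disjointUnion i k)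
                                        (⊆-without O i k Oik)
  rent<profit : R * (t (insert O i k) - t O) < ℕ→ℚ (p i k)
  rent<profit = ≤-<-trans (*-monoˡ-≤-0≤ R (<⇒≤ R-pos) extra-time) hyp
  gain : f (insert O i k) - f O ≡ ℕ→ℚ (p i k) - R * (t (insert O i k) - t O)
  gain = trans (objective-gain (insert-disjointUnion O i k Oik))
               (cong (λ P → P - R * (t (insert O i k) - t O)) (profit-item i k))
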